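{- Let $G$ be a finite group and $C\subset G$ an abundant conjugacy class. Then for every positive integer $n$ divisible by $|G|^2$ there exists $s\in G\backslash\operatorname{Sur}^C_1(F_n,G)$ such that the image of the stabilizer of $s$ under $B_n\to S_n$ contains an $n$-cycle.
   Context: A conjugacy class $C$ of $G$ is abundant if for some $x\in C$ there is $y\in G$ such that $\{y^{ -r}xy^r:r\in\mathbb Z\}$ generates $G$. $\operatorname{Sur}^C_1(F_n,G)$ is identified with the set of $(g_1,\dots,g_n)\in C^n$ with $\langle g_1,\dots,g_n\rangle=G$ and $g_1\cdots g_n=1$. $B_n$ acts on it from the right by $(\dots,g_i,g_{i+1},\dots)^{\sigma_i}=(\dots,g_{i+1},g_{i+1}^{ -1}g_ig_{i+1},\dots)$; $G$ acts on the left by simultaneous conjugation, commuting with the $B_n$-action, and $G\backslash\operatorname{Sur}^C_1(F_n,G)$ denotes the set of $G$-orbits with the induced $B_n$-action. $B_n\to S_n$ sends $\sigma_i\mapsto(i\ i+1)$. -}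

module Defs where

open import Level using (Level; _⊔_)
open import Algebra.Bundles using (Group)
open import Data.Nat using (ℕ; zero; suc; _<_)
open import Data.Integer using (ℤ; +_; -[1+_])
open import Data.Fin using (Fin)
open import Data.Vec using (Vec; []; _∷_; foldr; lookup; allFin)
open import Data.List using (List)
open import Data.Bool using (Bool; true; false)
open import Data.Product using (Σ; ∃; ∃-syntax; _×_; _,_)
open import Data.Vec.Relation.Unary.All using (All)
open import Function.Bundles using (Inverse)
import Relation.Binary.PropositionalEquality as ≡

-- A letter σ_i^{±1} of B_n, for 1 ≤ i+1 ≤ n-1 (0-based index i with i+1 < n).
-- The Bool records the sign: true = σ_i, false = σ_i⁻¹.
record BraidLetter (n : ℕ) : Set where
  constructor σ
  field
    idx   : ℕ
    valid : suc idx < n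
    pos   : Bool

BraidWord : ℕ → Set
BraidWord n = List (BraidLetter n)

swapAt : ∀ {a} {A : Set a} {n : ℕ} → ℕ → Vec A n → Vec A n
swapAt zero    (x ∷ y ∷ r) = y ∷ x ∷ r
swapAt zero    v           = v
swapAt (suc i) []          = []
swapAt (suc i) (x ∷ r)     = x ∷ swapAt i r

-- Image of a braid word under B_n → S_n (σ_i ↦ (i i+1)): we apply the
-- transpositions to the list of labels 0..n-1; the result, read as a
-- function Fin n → Fin n, is the image permutation.
permVec : ∀ {n} → BraidWord n → Vec (Fin n) n → Vec (Fin n) n
permVec List.[] v = v
permVec (σ i _ _ List.∷ w) v = permVec w (swapAt i v)

permOf : ∀ {n} → BraidWord n → Fin n → Fin n
permOf {n} w = lookup (permVec w (allFin n))

iterate : ∀ {a} {A : Set a} → (A → A) → ℕ → A → A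
iterate f zero    x = x
iterate f (suc k) x = f (iterate f k x)

IsNCycle : ∀ {n} → (Fin n → Fin n) → Set
IsNCycle {n} π = ∀ (i j : Fin n) → ∃[ k ] iterate π k i ≡.≡ j

module _ {c ℓ : Level} (G : Group c ℓ) where
  open Group G

  HasOrder : ℕ → Set (c ⊔ ℓ)
  HasOrder m = Inverse (≡.setoid (Fin m)) setoid

  pow : Carrier → ℕ → Carrier
  pow y zero    = ε
  pow y (suc k) = y ∙ pow y k

  zpow : Carrier → ℤ → Carrier
  zpow y (+ k)      = pow y k
  zpow y -[1+ k ]   = pow (y ⁻¹) (suc k)

  data InGen (S : Carrier → Set ℓ) : Carrier → Set (c ⊔ ℓ) where
    gen  : ∀ {x} → S x → InGen S x
    one  : InGen S ε
    inv  : ∀ {x} → InGen S x → InGen S (x ⁻¹)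
    mul  : ∀ {x y} → InGen S x → InGen S y → InGen S (x ∙ y)
    resp : ∀ {x y} → x ≈ y → InGen S x → InGen S y

  Generates : (Carrier → Set ℓ) → Set (c ⊔ ℓ)
  Generates S = ∀ g → InGen S g

  InClass : Carrier → Carrier → Set (c ⊔ ℓ)
  InClass r x = ∃[ h ] x ≈ (h ⁻¹ ∙ r) ∙ h

  Abundant : Carrier → Set (c ⊔ ℓ)
  Abundant r = ∃[ x ] ∃[ y ] (InClass r x ×
      Generates (λ z → ∃[ k ] z ≈ (zpow y k ⁻¹ ∙ x) ∙ zpow y k))

  -- elements of Sur^C_1(F_n, G), C = class of r
  InSur : Carrier → ∀ {n} → Vec Carrier n → Set (c ⊔ ℓ)
  InSur r g = All (InClass r) g
            × Generates (λ z → ∃[ j ] z ≈ lookup g j)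
            × (foldr _ _∙_ ε g ≈ ε)

  -- Hurwitz action of a single letter (right action)
  hurAt : ℕ → Bool → ∀ {n} → Vec Carrier n → Vec Carrier n
  hurAt zero    true  (a ∷ b ∷ r) = b ∷ ((b ⁻¹ ∙ a) ∙ b) ∷ r
  hurAt zero    false (a ∷ b ∷ r) = ((a ∙ b) ∙ a ⁻¹) ∷ a ∷ r
  hurAt zero    _     v           = v
  hurAt (suc i) _     []          = []
  hurAt (suc i) e     (x ∷ r)     = x ∷ hurAt i e r

  hurwitz : ∀ {n} → Vec Carrier n → BraidWord n → Vec Carrier n
  hurwitz g List.[] = g
  hurwitz g (σ i _ e List.∷ w) = hurwitz (hurAt i e g) w

  SameOrbit : ∀ {n} → Vec Carrier n → Vec Carrier n → Set (c ⊔ ℓ)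
  SameOrbit g g' = ∃[ h ] ∀ j → lookup g' j ≈ (h ∙ lookup g j) ∙ h ⁻¹

  StabilizesOrbit : ∀ {n} → Vec Carrier n → BraidWord n → Set (c ⊔ ℓ)
  StabilizesOrbit g w = SameOrbit g (hurwitz g w)

{-# OPTIONS --safe #-}
module Submission where

-- Write n = k + 1 and xᵃ = a⁻¹ x a, and take x ∈ C and y as in the definition
-- of abundance.  Since |G| ∣ n, Lagrange gives
-- yⁿ = (x y⁻¹)ⁿ = 1.  The tuple g = (x, xʸ, …, x^(yᵏ)) then lies in Cⁿ, its
-- entries include every generator x^(yʳ), r ∈ ℤ, and its product telescopes
-- to (x y⁻¹)ⁿ yⁿ = 1.  The braid σ₁σ₂⋯σₖ sends a tuple with product 1 to its
-- rotation (g₂, …, gₙ, g₁), which for our g is gʸ, and it maps to the n-cycle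
-- i ↦ i + 1 in Sₙ.  Lagrange's theorem for ⟨a⟩ is proved by splitting G into
-- the orbits of left multiplication by a, all of size the order of a.

open import Defs
open import Level using (Level)
open import Algebra.Bundles using (Group)
open import Data.Bool using (true)
open import Data.Fin using (Fin; zero; suc; toℕ; fromℕ; fromℕ<; inject₁; _≟_)
open import Data.Fin.Induction using (<-weakInduction; >-weakInduction)
open import Data.Fin.Properties
  using (¬∀⟶∃¬-smallest; pigeonhole; toℕ-fromℕ; toℕ-fromℕ<; toℕ-inject)
open import Data.Fin.Subset using (Subset; inside; outside; _∈_; _∉_; _-_; _⊂_; ∣_∣; ⊤)
open import Data.Fin.Subset.Induction using (⊂-wellFounded; Acc; acc)
open import Data.Fin.Subset.Properties
  using (p─⊥≡p; p─q⊆p; x∈p∧x≢y⇒x∈p-y; nonempty?; Empty-unique; ∣⊥∣≡0; ∣⊤∣≡n; ∈⊤)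
import Data.Integer as ℤ
import Data.List as List
open import Data.Nat using (ℕ; zero; suc; _+_; _*_; _<_; _≤_; z≤n; s≤s; z<s; NonZero)
open import Data.Nat.Divisibility using (_∣_; divides; _∣0; ∣-refl; ∣-trans; ∣m∣n⇒∣m+n; m∣m*n; n∣m*n)
open import Data.Nat.DivMod using (_%_; _/_; m≡m%n+[m/n]*n; m%n<n)
open import Data.Nat.Properties
  using (≤-refl; ≤-pred; <⇒≤; +-suc; +-comm; n<1+n; m<n⇒m<1+n; m<1+n⇒m<n∨m≡n; m≤n⇒∃[o]m+o≡n)
open import Data.Product using (∃-syntax; _×_; _,_; proj₁; proj₂)
open import Data.Sum using (inj₁; inj₂)
open import Data.Vec using (Vec; []; _∷_; _∷ʳ_; lookup; tabulate; foldr; here; there)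
open import Data.Vec.Properties using (lookup∘tabulate)
open import Data.Vec.Relation.Unary.All using (All)
open import Data.Vec.Relation.Unary.All.Properties using (tabulate⁺)
open import Function using (_∘_; _∘′_)
open import Function.Bundles using (Inverse; Injection)
open import Function.Properties.Inverse using (Inverse⇒Injection)
import Function.Construct.Symmetry as Symmetry
open import Relation.Nullary using (¬_; ¬?; yes; no)
open import Relation.Nullary.Decidable using (decidable-stable; via-injection)
open import Relation.Unary using (Decidable)
import Relation.Binary.Definitions as B
import Relation.Binary.PropositionalEquality as ≡
open ≡ using (_≡_; _≢_; module ≡-Reasoning)

iterate-+ : ∀ {a} {A : Set a} (f : A → A) i j x →
            iterate f (i + j) x ≡ iterate f i (iterate f j x)
iterate-+ f zero    j x = ≡.refl
iterate-+ f (suc i) j x = ≡.cong f (iterate-+ f i j x)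

iterate-suc′ : ∀ {a} {A : Set a} (f : A → A) k x → iterate f (suc k) x ≡ iterate f k (f x)
iterate-suc′ f zero    x = ≡.refl
iterate-suc′ f (suc k) x = ≡.cong f (iterate-suc′ f k x)

least-positive-witness : ∀ {p} {P : ℕ → Set p} → Decidable P → ∀ {d} → P (suc d) →
                         ∃[ e ] (P (suc e) × (∀ {k} → k < e → ¬ P (suc k)))
least-positive-witness {P = P} P? {d} Pd
  with i , ¬¬Pi , below ← ¬∀⟶∃¬-smallest (suc d) (λ i → ¬ P (suc (toℕ i)))
         (¬? ∘ P? ∘ suc ∘ toℕ) (λ none → none (fromℕ d) (≡.subst (P ∘ suc) (≡.sym (toℕ-fromℕ d)) Pd))
  = toℕ i , decidable-stable (P? _) ¬¬Pi ,
    λ k<i → ≡.subst (¬_ ∘ P ∘ suc) (≡.trans (toℕ-inject _) (toℕ-fromℕ< k<i)) (below (fromℕ< k<i))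

-- Orbits of a map all of whose orbits have the same size

x∉p-x : ∀ {n} (p : Subset n) x → x ∉ p - x
x∉p-x (_ ∷ p) (suc x) (there x∈p-x) = x∉p-x p x x∈p-x

x∈p⇒∣p∣≡1+∣p-x∣ : ∀ {n} {p : Subset n} {x} → x ∈ p → ∣ p ∣ ≡ suc ∣ p - x ∣
x∈p⇒∣p∣≡1+∣p-x∣ {p = inside  ∷ p} here        = ≡.cong (suc ∘′ ∣_∣) (≡.sym (p─⊥≡p p))
x∈p⇒∣p∣≡1+∣p-x∣ {p = outside ∷ p} (there x∈p) = x∈p⇒∣p∣≡1+∣p-x∣ x∈p
x∈p⇒∣p∣≡1+∣p-x∣ {p = inside  ∷ p} (there x∈p) = ≡.cong suc (x∈p⇒∣p∣≡1+∣p-x∣ x∈p)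

module PeriodicMap {m : ℕ} (f : Fin m → Fin m) (d : ℕ)
  (period    : ∀ y → iterate f (suc d) y ≡ y)
  (aperiodic : ∀ y {k} → k < d → iterate f (suc k) y ≢ y) where

  f-injective : ∀ {a b} → f a ≡ f b → a ≡ b
  f-injective {a} {b} fa≡fb = begin
    a                    ≡⟨ period a ⟨
    iterate f (suc d) a  ≡⟨ iterate-suc′ f d a ⟩
    iterate f d (f a)    ≡⟨ ≡.cong (iterate f d) fa≡fb ⟩
    iterate f d (f b)    ≡⟨ iterate-suc′ f d b ⟨
    iterate f (suc d) b  ≡⟨ period b ⟩
    b                    ∎
    where open ≡-Reasoning

  orbit-distinct : ∀ z {i j} → i < j → j ≤ d → iterate f j z ≢ iterate f i z
  orbit-distinct z {zero}  {suc j} _         j<d = aperiodic z j<d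
  orbit-distinct z {suc i} {suc j} (s≤s i<j) j<d = orbit-distinct z i<j (<⇒≤ j<d) ∘′ f-injective

  Closed : Subset m → Set
  Closed p = ∀ {y} → y ∈ p → f y ∈ p

  closed-iterate : ∀ {p z} → Closed p → z ∈ p → ∀ j → iterate f j z ∈ p
  closed-iterate closed z∈p zero    = z∈p
  closed-iterate closed z∈p (suc j) = closed (closed-iterate closed z∈p j)

  removeOrbit : Subset m → Fin m → ℕ → Subset m
  removeOrbit p z zero    = p
  removeOrbit p z (suc j) = removeOrbit p z j - iterate f j z

  ∈-removeOrbit⁻ : ∀ {p z y} j → y ∈ removeOrbit p z j →
                   y ∈ p × (∀ {i} → i < j → y ≢ iterate f i z)
  ∈-removeOrbit⁻ zero y∈p = y∈p , λ ()
  ∈-removeOrbit⁻ {z = z} {y} (suc j) y∈q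
    with y∈p , y∉orbit ← ∈-removeOrbit⁻ j (p─q⊆p _ _ y∈q) = y∈p , avoids
    where
    avoids : ∀ {i} → i < suc j → y ≢ iterate f i z
    avoids i<1+j with m<1+n⇒m<n∨m≡n i<1+j
    ... | inj₁ i<j   = y∉orbit i<j
    ... | inj₂ ≡.refl = λ { ≡.refl → x∉p-x _ y y∈q }

  ∈-removeOrbit⁺ : ∀ {p z y} j → y ∈ p → (∀ {i} → i < j → y ≢ iterate f i z) →
                   y ∈ removeOrbit p z j
  ∈-removeOrbit⁺ zero    y∈p _       = y∈p
  ∈-removeOrbit⁺ (suc j) y∈p y∉orbit = x∈p∧x≢y⇒x∈p-y
    (∈-removeOrbit⁺ j y∈p (y∉orbit ∘′ m<n⇒m<1+n)) (y∉orbit (n<1+n j))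

  ∣removeOrbit∣ : ∀ {p z} → Closed p → z ∈ p → ∀ j → j ≤ suc d →
                  ∣ p ∣ ≡ j + ∣ removeOrbit p z j ∣
  ∣removeOrbit∣ closed z∈p zero    _     = ≡.refl
  ∣removeOrbit∣ {p} {z} closed z∈p (suc j) j<1+d = begin
    ∣ p ∣                                ≡⟨ ∣removeOrbit∣ closed z∈p j (<⇒≤ j<1+d) ⟩
    j + ∣ removeOrbit p z j ∣            ≡⟨ ≡.cong (j +_) (x∈p⇒∣p∣≡1+∣p-x∣ fʲz∈q) ⟩
    j + suc ∣ removeOrbit p z (suc j) ∣  ≡⟨ +-suc j _ ⟩
    suc j + ∣ removeOrbit p z (suc j) ∣  ∎
    where
    open ≡-Reasoning
    fʲz∈q : iterate f j z ∈ removeOrbit p z j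
    fʲz∈q = ∈-removeOrbit⁺ j (closed-iterate closed z∈p j)
              (λ i<j → orbit-distinct z i<j (≤-pred j<1+d))

  removeOrbit-closed : ∀ {p z} → Closed p → Closed (removeOrbit p z (suc d))
  removeOrbit-closed {z = z} closed {y} y∈q
    with y∈p , y∉orbit ← ∈-removeOrbit⁻ (suc d) y∈q =
    ∈-removeOrbit⁺ (suc d) (closed y∈p) fy∉orbit
    where
    fy∉orbit : ∀ {i} → i < suc d → f y ≢ iterate f i z
    fy∉orbit {zero}  _         fy≡z     =
      y∉orbit (n<1+n d) (f-injective (≡.trans fy≡z (≡.sym (period z))))
    fy∉orbit {suc i} (s≤s i<d) fy≡fⁱ⁺¹z = y∉orbit (m<n⇒m<1+n i<d) (f-injective fy≡fⁱ⁺¹z)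

  removeOrbit⊂ : ∀ {p z} → z ∈ p → removeOrbit p z (suc d) ⊂ p
  removeOrbit⊂ z∈p = (λ y∈q → proj₁ (∈-removeOrbit⁻ (suc d) y∈q)) ,
    _ , z∈p , λ z∈q → proj₂ (∈-removeOrbit⁻ (suc d) z∈q) z<s ≡.refl

  period∣∣closed∣ : ∀ {p} → Closed p → suc d ∣ ∣ p ∣
  period∣∣closed∣ {p} = go p (⊂-wellFounded p)
    where
    go : ∀ p → Acc _⊂_ p → Closed p → suc d ∣ ∣ p ∣
    go p (acc smaller) closed with nonempty? p
    ... | no empty = ≡.subst (suc d ∣_)
      (≡.sym (≡.trans (≡.cong ∣_∣ (Empty-unique empty)) (∣⊥∣≡0 m))) (suc d ∣0)
    ... | yes (z , z∈p) = ≡.subst (suc d ∣_) (≡.sym (∣removeOrbit∣ closed z∈p (suc d) ≤-refl))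
      (∣m∣n⇒∣m+n ∣-refl (go _ (smaller (removeOrbit⊂ z∈p)) (removeOrbit-closed closed)))

  period∣m : suc d ∣ m
  period∣m = ≡.subst (suc d ∣_) (∣⊤∣≡n m) (period∣∣closed∣ {⊤} (λ _ → ∈⊤))

-- The braid σ₁σ₂⋯σₖ

shiftLetter : ∀ {n} → BraidLetter n → BraidLetter (suc n)
shiftLetter (σ i valid e) = σ (suc i) (s≤s valid) e

shiftWord : ∀ {n} → BraidWord n → BraidWord (suc n)
shiftWord = List.map shiftLetter

-- Letters are indexed from 0, so σ 0 is σ₁.
cycleWord : ∀ k → BraidWord (suc k)
cycleWord zero    = List.[]
cycleWord (suc k) = σ 0 (s≤s (s≤s z≤n)) true List.∷ shiftWord (cycleWord k)

-- permVec with an arbitrary entry type: induction along shiftWord changes the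
-- length, and permVec ties the entry type Fin n to it.
permute : ∀ {a} {A : Set a} {n} → BraidWord n → Vec A n → Vec A n
permute List.[]            v = v
permute (σ i _ _ List.∷ w) v = permute w (swapAt i v)

permVec≡permute : ∀ {n} (w : BraidWord n) v → permVec w v ≡ permute w v
permVec≡permute List.[]            v = ≡.refl
permVec≡permute (σ i _ _ List.∷ w) v = permVec≡permute w (swapAt i v)

permute-shiftWord : ∀ {a} {A : Set a} {n} (w : BraidWord n) (x : A) v →
                    permute (shiftWord w) (x ∷ v) ≡ x ∷ permute w v
permute-shiftWord List.[]            x v = ≡.refl
permute-shiftWord (σ i _ _ List.∷ w) x v = permute-shiftWord w x (swapAt i v)

permute-cycleWord : ∀ {a} {A : Set a} k (x : A) (v : Vec A k) →
                    permute (cycleWord k) (x ∷ v) ≡ v ∷ʳ x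
permute-cycleWord zero    x []      = ≡.refl
permute-cycleWord (suc k) x (y ∷ v) = begin
  permute (shiftWord (cycleWord k)) (y ∷ x ∷ v)  ≡⟨ permute-shiftWord (cycleWord k) y (x ∷ v) ⟩
  y ∷ permute (cycleWord k) (x ∷ v)             ≡⟨ ≡.cong (y ∷_) (permute-cycleWord k x v) ⟩
  y ∷ (v ∷ʳ x)                                  ∎
  where open ≡-Reasoning

lookup-∷ʳ-inject₁ : ∀ {a} {A : Set a} {n} (v : Vec A n) x i → lookup (v ∷ʳ x) (inject₁ i) ≡ lookup v i
lookup-∷ʳ-inject₁ (y ∷ v) x zero    = ≡.refl
lookup-∷ʳ-inject₁ (y ∷ v) x (suc i) = lookup-∷ʳ-inject₁ v x i

lookup-∷ʳ-fromℕ : ∀ {a} {A : Set a} {n} (v : Vec A n) x → lookup (v ∷ʳ x) (fromℕ n) ≡ x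
lookup-∷ʳ-fromℕ []      x = ≡.refl
lookup-∷ʳ-fromℕ (y ∷ v) x = lookup-∷ʳ-fromℕ v x

tabulate-∷ʳ : ∀ {a} {A : Set a} {n} (X : ℕ → A) → tabulate {suc n} (X ∘ toℕ) ≡ tabulate {n} (X ∘ toℕ) ∷ʳ X n
tabulate-∷ʳ {n = zero}  X = ≡.refl
tabulate-∷ʳ {n = suc n} X = ≡.cong (X 0 ∷_) (tabulate-∷ʳ (X ∘ suc))

cyclicSuccessor-isNCycle : ∀ {n} (π : Fin (suc n) → Fin (suc n)) →
  (∀ i → π (inject₁ i) ≡ suc i) → π (fromℕ n) ≡ zero → IsNCycle π
cyclicSuccessor-isNCycle π π-inject₁ π-fromℕ i j =
  let s , πˢi≡0 = reaches-zero i
      t , πᵗ0≡j = reached-from-zero j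
  in t + s , ≡.trans (iterate-+ π t s i) (≡.trans (≡.cong (iterate π t) πˢi≡0) πᵗ0≡j)
  where
  reaches-zero : ∀ i → ∃[ s ] iterate π s i ≡ zero
  reaches-zero = >-weakInduction _ (1 , π-fromℕ)
    (λ { i (s , πˢ[i+1]≡0) → suc s , ≡.trans (iterate-suc′ π s _)
                                       (≡.trans (≡.cong (iterate π s) (π-inject₁ i)) πˢ[i+1]≡0) })
  reached-from-zero : ∀ j → ∃[ t ] iterate π t zero ≡ j
  reached-from-zero = <-weakInduction _ (0 , ≡.refl)
    (λ { j (t , πᵗ0≡j) → suc t , ≡.trans (≡.cong π πᵗ0≡j) (π-inject₁ j) })

cycleWord-isNCycle : ∀ k → IsNCycle (permOf (cycleWord k))
cycleWord-isNCycle k = ≡.subst (IsNCycle ∘ lookup) (≡.sym rotation)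
  (cyclicSuccessor-isNCycle _
    (λ i → ≡.trans (lookup-∷ʳ-inject₁ (tabulate suc) zero i) (lookup∘tabulate suc i))
    (lookup-∷ʳ-fromℕ (tabulate suc) zero))
  where
  rotation : permVec (cycleWord k) (zero ∷ tabulate suc) ≡ tabulate suc ∷ʳ zero
  rotation = ≡.trans (permVec≡permute (cycleWord k) _) (permute-cycleWord k zero (tabulate suc))

module _ {c ℓ : Level} (G : Group c ℓ) where
  open Group G
  open import Algebra.Properties.Group G
    using (ε⁻¹≈ε; inverseˡ-unique; inverseʳ-unique; ⁻¹-anti-homo-∙; ⁻¹-involutive; loop)
  open import Algebra.Properties.Loop loop using (identityˡ-unique)
  open import Algebra.Properties.Monoid monoid using (cancelˡ; elimˡ; elimʳ; insertᶜ)
  open import Relation.Binary.Reasoning.Setoid setoid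

  pow-cong : ∀ {g h} k → g ≈ h → pow G g k ≈ pow G h k
  pow-cong zero    _   = refl
  pow-cong (suc k) g≈h = ∙-cong g≈h (pow-cong k g≈h)

  pow-+ : ∀ g i j → pow G g (i + j) ≈ pow G g i ∙ pow G g j
  pow-+ g zero    j = sym (identityˡ _)
  pow-+ g (suc i) j = trans (∙-congˡ (pow-+ g i j)) (sym (assoc _ _ _))

  pow-* : ∀ g i j → pow G g (i * j) ≈ pow G (pow G g j) i
  pow-* g zero    j = refl
  pow-* g (suc i) j = trans (pow-+ g j (i * j)) (∙-congˡ (pow-* g i j))

  pow-sucʳ : ∀ g k → pow G g (suc k) ≈ pow G g k ∙ g
  pow-sucʳ g zero    = trans (identityʳ g) (sym (identityˡ g))
  pow-sucʳ g (suc k) = trans (∙-congˡ (pow-sucʳ g k)) (sym (assoc _ _ _))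

  pow-ε : ∀ k → pow G ε k ≈ ε
  pow-ε zero    = refl
  pow-ε (suc k) = trans (identityˡ _) (pow-ε k)

  pow-∣ : ∀ g {e n} → e ∣ n → pow G g e ≈ ε → pow G g n ≈ ε
  pow-∣ g {e} (divides q ≡.refl) gᵉ≈ε = begin
    pow G g (q * e)      ≈⟨ pow-* g q e ⟩
    pow G (pow G g e) q  ≈⟨ pow-cong q gᵉ≈ε ⟩
    pow G ε q            ≈⟨ pow-ε q ⟩
    ε                    ∎

  pow-mod : ∀ g {n} .{{_ : NonZero n}} → pow G g n ≈ ε → ∀ t → pow G g t ≈ pow G g (t % n)
  pow-mod g {n} gⁿ≈ε t = begin
    pow G g t                                ≡⟨ ≡.cong (pow G g) (m≡m%n+[m/n]*n t n) ⟩
    pow G g (t % n + (t / n) * n)            ≈⟨ pow-+ g (t % n) _ ⟩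
    pow G g (t % n) ∙ pow G g ((t / n) * n)  ≈⟨ elimʳ (pow-∣ g (n∣m*n (t / n)) gⁿ≈ε) _ ⟩
    pow G g (t % n)                          ∎

  zpow-as-pow : ∀ g {k} → pow G g (suc k) ≈ ε → ∀ r → ∃[ t ] zpow G g r ≈ pow G g t
  zpow-as-pow g     _      (ℤ.+ t)    = t , refl
  zpow-as-pow g {k} gᵏ⁺¹≈ε ℤ.-[1+ t ] = suc t * k , (begin
    pow G (g ⁻¹) (suc t)       ≈⟨ pow-cong (suc t) (inverseʳ-unique g _ gᵏ⁺¹≈ε) ⟨
    pow G (pow G g k) (suc t)  ≈⟨ pow-* g (suc t) k ⟨
    pow G g (suc t * k)        ∎)

  conj : Carrier → Carrier → Carrier
  conj a x = (a ⁻¹ ∙ x) ∙ a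

  conj-cong : ∀ {a b x y} → a ≈ b → x ≈ y → conj a x ≈ conj b y
  conj-cong a≈b x≈y = ∙-cong (∙-cong (⁻¹-cong a≈b) x≈y) a≈b

  conj-ε : ∀ x → conj ε x ≈ x
  conj-ε x = trans (identityʳ _) (trans (∙-congʳ ε⁻¹≈ε) (identityˡ x))

  conj-∙ : ∀ a b x → conj (a ∙ b) x ≈ conj b (conj a x)
  conj-∙ a b x = begin
    ((a ∙ b) ⁻¹ ∙ x) ∙ (a ∙ b)     ≈⟨ ∙-congʳ (∙-congʳ (⁻¹-anti-homo-∙ a b)) ⟩
    ((b ⁻¹ ∙ a ⁻¹) ∙ x) ∙ (a ∙ b)  ≈⟨ ∙-congʳ (assoc _ _ _) ⟩
    (b ⁻¹ ∙ (a ⁻¹ ∙ x)) ∙ (a ∙ b)  ≈⟨ assoc _ _ _ ⟨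
    ((b ⁻¹ ∙ (a ⁻¹ ∙ x)) ∙ a) ∙ b  ≈⟨ ∙-congʳ (assoc _ _ _) ⟩
    (b ⁻¹ ∙ ((a ⁻¹ ∙ x) ∙ a)) ∙ b  ∎

  conj-by-inverse : ∀ {a b} → a ∙ b ≈ ε → conj b a ≈ a
  conj-by-inverse {a} {b} ab≈ε = begin
    (b ⁻¹ ∙ a) ∙ b  ≈⟨ ∙-congʳ (∙-congʳ (inverseˡ-unique a b ab≈ε)) ⟨
    (a ∙ a) ∙ b     ≈⟨ assoc a a b ⟩
    a ∙ (a ∙ b)     ≈⟨ elimʳ ab≈ε a ⟩
    a               ∎

  ∙-conj : ∀ a x → a ∙ conj a x ≈ x ∙ a
  ∙-conj a x = begin
    a ∙ ((a ⁻¹ ∙ x) ∙ a)  ≈⟨ assoc _ _ _ ⟨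
    (a ∙ (a ⁻¹ ∙ x)) ∙ a  ≈⟨ ∙-congʳ (cancelˡ (inverseʳ a) x) ⟩
    x ∙ a                 ∎

  InClass-conj : ∀ {r x} → InClass G r x → ∀ a → InClass G r (conj a x)
  InClass-conj {r} {x} (h , x≈rʰ) a = h ∙ a , (begin
    conj a x           ≈⟨ conj-cong refl x≈rʰ ⟩
    conj a (conj h r)  ≈⟨ conj-∙ h a r ⟨
    conj (h ∙ a) r     ∎)

  InGen-mono : ∀ {S T : Carrier → Set ℓ} → (∀ {u} → S u → InGen G T u) →
               ∀ {u} → InGen G S u → InGen G T u
  InGen-mono S⊆⟨T⟩ (gen s)      = S⊆⟨T⟩ s
  InGen-mono S⊆⟨T⟩ one          = one
  InGen-mono S⊆⟨T⟩ (inv a)      = inv (InGen-mono S⊆⟨T⟩ a)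
  InGen-mono S⊆⟨T⟩ (mul a b)    = mul (InGen-mono S⊆⟨T⟩ a) (InGen-mono S⊆⟨T⟩ b)
  InGen-mono S⊆⟨T⟩ (resp u≈v a) = resp u≈v (InGen-mono S⊆⟨T⟩ a)

  prod : ∀ {n} → Vec Carrier n → Carrier
  prod = foldr (λ _ → Carrier) _∙_ ε

  telescope : ∀ (u X : ℕ → Carrier) z → (∀ i → u i ∙ X i ≈ z ∙ u (suc i)) →
              ∀ t → u 0 ∙ prod (tabulate {t} (X ∘ toℕ)) ≈ pow G z t ∙ u t
  telescope u X z shift zero    = trans (identityʳ _) (sym (identityˡ _))
  telescope u X z shift (suc t) = begin
    u 0 ∙ (X 0 ∙ rest)           ≈⟨ assoc _ _ _ ⟨
    (u 0 ∙ X 0) ∙ rest           ≈⟨ ∙-congʳ (shift 0) ⟩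
    (z ∙ u 1) ∙ rest             ≈⟨ assoc _ _ _ ⟩
    z ∙ (u 1 ∙ rest)             ≈⟨ ∙-congˡ (telescope (u ∘ suc) (X ∘ suc) z (shift ∘ suc) t) ⟩
    z ∙ (pow G z t ∙ u (suc t))  ≈⟨ assoc _ _ _ ⟨
    pow G z (suc t) ∙ u (suc t)  ∎
    where rest = prod (tabulate {t} ((X ∘ suc) ∘ toℕ))

  conjBy : ∀ {n} → Vec Carrier n → Carrier → Carrier
  conjBy []      a = a
  conjBy (b ∷ v) a = conjBy v (conj b a)

  conjBy≈conj-prod : ∀ {n} (v : Vec Carrier n) a → conjBy v a ≈ conj (prod v) a
  conjBy≈conj-prod []      a = sym (conj-ε a)
  conjBy≈conj-prod (b ∷ v) a = trans (conjBy≈conj-prod v (conj b a)) (sym (conj-∙ b (prod v) a))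

  hurwitz-shiftWord : ∀ {n} (w : BraidWord n) a v → hurwitz G (a ∷ v) (shiftWord w) ≡ a ∷ hurwitz G v w
  hurwitz-shiftWord List.[]            a v = ≡.refl
  hurwitz-shiftWord (σ i _ e List.∷ w) a v = hurwitz-shiftWord w a (hurAt G i e v)

  hurwitz-cycleWord : ∀ k a (v : Vec Carrier k) → hurwitz G (a ∷ v) (cycleWord k) ≡ v ∷ʳ conjBy v a
  hurwitz-cycleWord zero    a []      = ≡.refl
  hurwitz-cycleWord (suc k) a (b ∷ v) =
    ≡.trans (hurwitz-shiftWord (cycleWord k) b (conj b a ∷ v))
            (≡.cong (b ∷_) (hurwitz-cycleWord k (conj b a) v))

  lookup-∷ʳ-cong : ∀ {n} (v : Vec Carrier n) {a b} → a ≈ b → ∀ j → lookup (v ∷ʳ a) j ≈ lookup (v ∷ʳ b) j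
  lookup-∷ʳ-cong []      a≈b zero    = a≈b
  lookup-∷ʳ-cong (_ ∷ _) _   zero    = refl
  lookup-∷ʳ-cong (_ ∷ v) a≈b (suc j) = lookup-∷ʳ-cong v a≈b j

  cycleWord-stabilizes : ∀ {k} (X : ℕ → Carrier) h → (∀ i → X (suc i) ≈ conj h (X i)) →
    X (suc k) ≈ X 0 → prod (tabulate {suc k} (X ∘ toℕ)) ≈ ε →
    StabilizesOrbit G (tabulate (X ∘ toℕ)) (cycleWord k)
  cycleWord-stabilizes {k} X h step periodic trivial = h ⁻¹ , λ j → begin
    lookup (hurwitz G (X 0 ∷ tail) (cycleWord k)) j   ≡⟨ ≡.cong (λ v → lookup v j) (hurwitz-cycleWord k (X 0) tail) ⟩
    lookup (tail ∷ʳ conjBy tail (X 0)) j             ≈⟨ lookup-∷ʳ-cong tail last≈ j ⟩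
    lookup (tail ∷ʳ X (suc k)) j                     ≡⟨ ≡.cong (λ v → lookup v j) (tabulate-∷ʳ (X ∘ suc)) ⟨
    lookup (tabulate ((X ∘ suc) ∘ toℕ)) j            ≡⟨ lookup∘tabulate ((X ∘ suc) ∘ toℕ) j ⟩
    X (suc (toℕ j))                                  ≈⟨ step (toℕ j) ⟩
    (h ⁻¹ ∙ X (toℕ j)) ∙ h                           ≈⟨ ∙-congˡ (⁻¹-involutive h) ⟨
    (h ⁻¹ ∙ X (toℕ j)) ∙ h ⁻¹ ⁻¹                     ≡⟨ ≡.cong (λ a → (h ⁻¹ ∙ a) ∙ h ⁻¹ ⁻¹) (lookup∘tabulate (X ∘ toℕ) j) ⟨
    (h ⁻¹ ∙ lookup (tabulate (X ∘ toℕ)) j) ∙ h ⁻¹ ⁻¹  ∎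
    where
    tail = tabulate {k} ((X ∘ suc) ∘ toℕ)
    last≈ : conjBy tail (X 0) ≈ X (suc k)
    last≈ = begin
      conjBy tail (X 0)       ≈⟨ conjBy≈conj-prod tail (X 0) ⟩
      conj (prod tail) (X 0)  ≈⟨ conj-by-inverse trivial ⟩
      X 0                     ≈⟨ periodic ⟨
      X (suc k)               ∎

  module FiniteGroup {m : ℕ} (|G|≡m : HasOrder G m) where
    open Inverse |G|≡m using (to; from; to-cong; strictlyInverseˡ)

    from-injection : Injection setoid (≡.setoid (Fin m))
    from-injection = Inverse⇒Injection (Symmetry.inverse |G|≡m)

    _≈?_ : B.Decidable _≈_
    _≈?_ = via-injection from-injection _≟_

    has-period : ∀ g → ∃[ d ] pow G g (suc d) ≈ ε
    has-period g
      with i , j , i<j , gⁱ≡gʲ ← pigeonhole (n<1+n m) (λ i → from (pow G g (toℕ i)))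
      with d , 1+i+d≡j ← m≤n⇒∃[o]m+o≡n i<j
      = d , identityˡ-unique _ _ (begin
        pow G g (suc d) ∙ pow G g (toℕ i)  ≈⟨ pow-+ g (suc d) (toℕ i) ⟨
        pow G g (suc d + toℕ i)            ≡⟨ ≡.cong (pow G g ∘ suc) (+-comm d (toℕ i)) ⟩
        pow G g (suc (toℕ i) + d)          ≡⟨ ≡.cong (pow G g) 1+i+d≡j ⟩
        pow G g (toℕ j)                    ≈⟨ Injection.injective from-injection gⁱ≡gʲ ⟨
        pow G g (toℕ i)                    ∎)

    order : ∀ g → ∃[ d ] (pow G g (suc d) ≈ ε × (∀ {k} → k < d → ¬ pow G g (suc k) ≈ ε))
    order g with d , gᵈ⁺¹≈ε ← has-period g = least-positive-witness (λ k → pow G g k ≈? ε) {d} gᵈ⁺¹≈ε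

    order∣|G| : ∀ g {d} → pow G g (suc d) ≈ ε → (∀ {k} → k < d → ¬ pow G g (suc k) ≈ ε) → suc d ∣ m
    order∣|G| g {d} gᵈ⁺¹≈ε minimal = PeriodicMap.period∣m translate d
      (λ y → Injection.injective (Inverse⇒Injection |G|≡m)
               (trans (to-iterate (suc d) y) (elimˡ gᵈ⁺¹≈ε (to y))))
      (λ y {k} k<d fixed → minimal k<d
         (identityˡ-unique _ (to y) (trans (sym (to-iterate (suc k) y)) (to-cong fixed))))
      where
      translate : Fin m → Fin m
      translate i = from (g ∙ to i)
      to-iterate : ∀ k i → to (iterate translate k i) ≈ pow G g k ∙ to i
      to-iterate zero    i = sym (identityˡ _)
      to-iterate (suc k) i = begin
        to (from (g ∙ to (iterate translate k i)))  ≈⟨ strictlyInverseˡ _ ⟩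
        g ∙ to (iterate translate k i)              ≈⟨ ∙-congˡ (to-iterate k i) ⟩
        g ∙ (pow G g k ∙ to i)                      ≈⟨ assoc _ _ _ ⟨
        pow G g (suc k) ∙ to i                      ∎

    pow-|G| : ∀ g → pow G g m ≈ ε
    pow-|G| g with _ , gᵈ⁺¹≈ε , minimal ← order g = pow-∣ g (order∣|G| g gᵈ⁺¹≈ε minimal) gᵈ⁺¹≈ε

  module ConjugatesByPowers (x y : Carrier) (k : ℕ)
    (yⁿ≈ε : pow G y (suc k) ≈ ε) (⟨xy⁻¹⟩ⁿ≈ε : pow G (x ∙ y ⁻¹) (suc k) ≈ ε) where

    X : ℕ → Carrier
    X i = conj (pow G y i) x

    tuple : Vec Carrier (suc k)
    tuple = tabulate (X ∘ toℕ)

    tuple-inClass : ∀ {r} → InClass G r x → All (InClass G r) tuple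
    tuple-inClass x∈C = tabulate⁺ (λ j → InClass-conj x∈C (pow G y (toℕ j)))

    tuple-generates : Generates G (λ u → ∃[ r ] u ≈ conj (zpow G y r) x) →
                      Generates G (λ u → ∃[ j ] u ≈ lookup tuple j)
    tuple-generates generates u = InGen-mono is-entry (generates u)
      where
      is-entry : ∀ {u} → ∃[ r ] u ≈ conj (zpow G y r) x → InGen G (λ u → ∃[ j ] u ≈ lookup tuple j) u
      is-entry {u} (r , u≈xʸʳ) with t , yʳ≈yᵗ ← zpow-as-pow y {k} yⁿ≈ε r =
        let j = fromℕ< (m%n<n t (suc k)) in
        gen (j , (begin
          u                    ≈⟨ u≈xʸʳ ⟩
          conj (zpow G y r) x  ≈⟨ conj-cong (trans yʳ≈yᵗ (pow-mod y yⁿ≈ε t)) refl ⟩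
          X (t % suc k)        ≡⟨ ≡.cong X (toℕ-fromℕ< (m%n<n t (suc k))) ⟨
          X (toℕ j)            ≡⟨ lookup∘tabulate (X ∘ toℕ) j ⟨
          lookup tuple j       ∎))

    tuple-product : prod tuple ≈ ε
    tuple-product = begin
      prod tuple                                  ≈⟨ identityˡ _ ⟨
      ε ∙ prod tuple                              ≈⟨ telescope (pow G y) X (x ∙ y ⁻¹) shift (suc k) ⟩
      pow G (x ∙ y ⁻¹) (suc k) ∙ pow G y (suc k)  ≈⟨ elimˡ ⟨xy⁻¹⟩ⁿ≈ε _ ⟩
      pow G y (suc k)                             ≈⟨ yⁿ≈ε ⟩
      ε                                           ∎
      where
      shift : ∀ i → pow G y i ∙ X i ≈ (x ∙ y ⁻¹) ∙ pow G y (suc i)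
      shift i = trans (∙-conj (pow G y i) x) (insertᶜ (inverseˡ y) x (pow G y i))

    tuple-stabilized : StabilizesOrbit G tuple (cycleWord k)
    tuple-stabilized = cycleWord-stabilizes X y
      (λ i → trans (conj-cong (pow-sucʳ y i) refl) (conj-∙ (pow G y i) y x))
      (conj-cong yⁿ≈ε refl)
      tuple-product

mainTheorem19 : ∀ {c ℓ : Level} (G : Group c ℓ) (m : ℕ) → HasOrder G m →
    (r : Group.Carrier G) → Abundant G r →
    ∀ (n : ℕ) → 0 < n → (m * m) ∣ n →
    ∃[ g ] (InSur G r {n} g ×
      ∃[ w ] (StabilizesOrbit G g w × IsNCycle (permOf w)))
mainTheorem19 G m |G|≡m r (x , y , x∈C , generates) (suc k) _ m²∣n =
  tuple , (tuple-inClass x∈C , tuple-generates generates , tuple-product) ,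
  cycleWord k , tuple-stabilized , cycleWord-isNCycle k
  where
  open Group G using (_≈_; _∙_; _⁻¹; ε)
  open FiniteGroup G |G|≡m using (pow-|G|)
  pow-n : ∀ g → pow G g (suc k) ≈ ε
  pow-n g = pow-∣ G g {m} (∣-trans (m∣m*n m) m²∣n) (pow-|G| g)
  open ConjugatesByPowers G x y k (pow-n y) (pow-n (x ∙ y ⁻¹))
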